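{- For an integer $n\ge 2$ let $p(n)=(1+n)(1+2n+5n^2+n^3)$ and $q(n)=(1+2n)(1+n+n^2)$, and let $$R(n)=\Big(2,3,4,\dots,n,\ \frac{ -p(-(1+n))}{q(n)},\ \frac{p(n)}{q(n)}\Big).$$ Then $\nu(R(n))=0$.
   Context: For a finite sequence $(a_1,\dots,a_N)$ of rational numbers, $\nu(a_1,\dots,a_N)=\big(\sum a_i\big)^2-\sum a_i^3$. -}

module Defs where

open import Data.Nat as ℕ using (ℕ; suc)
open import Data.Integer as ℤ using (ℤ; +_)
open import Data.Rational as ℚ using (ℚ; _/_)
open import Data.List using (List; []; _∷_; _++_; map; foldr; upTo)

Σℚ : List ℚ → ℚ
Σℚ = foldr ℚ._+_ ℚ.0ℚ

ν : List ℚ → ℚ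
ν as = (Σℚ as ℚ.* Σℚ as) ℚ.- Σℚ (map (λ a → a ℚ.* a ℚ.* a) as)

p : ℤ → ℤ
p x = (ℤ.1ℤ ℤ.+ x) ℤ.* (ℤ.1ℤ ℤ.+ (+ 2) ℤ.* x ℤ.+ (+ 5) ℤ.* (x ℤ.* x) ℤ.+ x ℤ.* x ℤ.* x)

-- q(n) = (1+2n)(1+n+n²), as a natural number (positive, so usable as denominator)
q : ℕ → ℕ
q n = suc (2 ℕ.* n) ℕ.* suc (n ℕ.+ n ℕ.* n)

R : ℕ → List ℚ
R n = map (λ k → + k / 1) (map (λ i → 2 ℕ.+ i) (upTo (n ℕ.∸ 1)))
      ++ (ℤ.- p (ℤ.- (+ (1 ℕ.+ n)))) / q n
       ∷ p (+ n) / q n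
       ∷ []

{-# OPTIONS --safe #-}
-- The entries 2, …, n contribute n(n+1)/2 − 1 to Σ aᵢ and (n(n+1)/2)² − 1 to Σ aᵢ³ (Gauss and
-- Nicomachus). Writing the last two entries as U/q and V/q with U = −p(−(1+n)) and V = p(n),
-- the number 4q³·ν(R(n)) becomes a polynomial in n, and that polynomial is identically zero.
module Submission where

open import Agda.Builtin.FromNat using (Number; fromNat)
open import Data.Integer as ℤ using (ℤ; +_; +[1+_]; -[1+_]; 1ℤ)
import Data.Integer.Properties as ℤ
open import Data.List using (List; []; _∷_; _++_; [_]; map; upTo)
import Data.List.Properties as List
open import Data.Nat as ℕ using (ℕ; zero; suc; _≤_)
import Data.Nat.Literals as ℕ
import Data.Nat.Properties as ℕ
open import Data.Rational using (ℚ; _/_; 0ℚ; _+_; _*_; _-_; -_; NonZero; 1/_; toℚᵘ)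
open import Data.Rational.Literals using (number; fromℤ)
open import Data.Rational.Properties
open import Data.Rational.Solver using (module +-*-Solver)
open import Data.Rational.Unnormalised using (mkℚᵘ; *≡*) renaming (_*_ to _*ᵘ_)
import Data.Rational.Unnormalised.Properties as ℚᵘ
open import Data.Unit.Base using (tt)
open import Function using (_∘_)
open import Relation.Binary.PropositionalEquality using (_≡_; refl; sym; trans; cong; cong₂; module ≡-Reasoning)

open import Defs

open +-*-Solver using (Polynomial; solve; _:=_; con; _:+_; _:*_; _:-_; :-_)

instance
  ℕ-number : Number ℕ
  ℕ-number = ℕ.number

  ℚ-number : Number ℚ
  ℚ-number = number

fromℕ : ℕ → ℚ
fromℕ n = fromℤ (+ n)

z/1≡fromℤ : ∀ z → z / 1 ≡ fromℤ z
z/1≡fromℤ z = ↥p/↧p≡p (fromℤ z)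

fromℤ-+ : ∀ x y → fromℤ (x ℤ.+ y) ≡ fromℤ x + fromℤ y
fromℤ-+ x y = begin
  fromℤ (x ℤ.+ y)               ≡⟨ z/1≡fromℤ (x ℤ.+ y) ⟨
  (x ℤ.+ y) / 1                 ≡⟨ cong (λ z → z / 1) (cong₂ ℤ._+_ (ℤ.*-identityʳ x) (ℤ.*-identityʳ y)) ⟨
  (x ℤ.* 1ℤ ℤ.+ y ℤ.* 1ℤ) / 1   ∎
  where open ≡-Reasoning

fromℤ-* : ∀ x y → fromℤ (x ℤ.* y) ≡ fromℤ x * fromℤ y
fromℤ-* x y = sym (z/1≡fromℤ (x ℤ.* y))

fromℤ-neg : ∀ x → fromℤ (ℤ.- x) ≡ - fromℤ x
fromℤ-neg (+ zero) = refl
fromℤ-neg +[1+ _ ] = refl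
fromℤ-neg -[1+ _ ] = refl

[z/d]*d≡z : ∀ z d .{{_ : ℕ.NonZero d}} → (z / d) * fromℕ d ≡ fromℤ z
[z/d]*d≡z z (suc k) = toℚᵘ-injective (begin
  toℚᵘ ((z / suc k) * fromℕ (suc k))     ≈⟨ toℚᵘ-homo-* (z / suc k) (fromℕ (suc k)) ⟩
  toℚᵘ (z / suc k) *ᵘ mkℚᵘ (+ suc k) 0   ≈⟨ ℚᵘ.*-congʳ (toℚᵘ-fromℚᵘ (mkℚᵘ z k)) ⟩
  mkℚᵘ z k *ᵘ mkℚᵘ (+ suc k) 0           ≈⟨ *≡* (ℤ.*-assoc z (+ suc k) (+ 1)) ⟩
  mkℚᵘ z 0                               ∎)
  where open ℚᵘ.≃-Reasoning

fromℕ-+ : ∀ m n → fromℕ (m ℕ.+ n) ≡ fromℕ m + fromℕ n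
fromℕ-+ m n = trans (cong fromℤ (ℤ.pos-+ m n)) (fromℤ-+ (+ m) (+ n))

fromℕ-* : ∀ m n → fromℕ (m ℕ.* n) ≡ fromℕ m * fromℕ n
fromℕ-* m n = trans (cong fromℤ (ℤ.pos-* m n)) (fromℤ-* (+ m) (+ n))

fromℕ-suc : ∀ n → fromℕ (suc n) ≡ fromℕ n + 1
fromℕ-suc n = trans (cong fromℕ (ℕ.+-comm 1 n)) (fromℕ-+ n 1)

pℚ : ℚ → ℚ
pℚ y = (1 + y) * (1 + 2 * y + 5 * (y * y) + y * y * y)

fromℤ-p : ∀ x → fromℤ (p x) ≡ pℚ (fromℤ x)
fromℤ-p x = begin
  fromℤ (p x)                                         ≡⟨ fromℤ-* (1ℤ ℤ.+ x) _ ⟩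
  fromℤ (1ℤ ℤ.+ x) * fromℤ (cubic ℤ.+ x ℤ.* x ℤ.* x)   ≡⟨ cong₂ _*_ (fromℤ-+ 1ℤ x) (fromℤ-+ cubic _) ⟩
  (1 + y) * (fromℤ cubic + fromℤ (x ℤ.* x ℤ.* x))     ≡⟨ cong (λ t → (1 + y) * t) (cong₂ _+_ fromℤ-cubic fromℤ-x³) ⟩
  pℚ y                                                ∎
  where
  open ≡-Reasoning
  y : ℚ
  y = fromℤ x
  cubic : ℤ
  cubic = 1ℤ ℤ.+ + 2 ℤ.* x ℤ.+ + 5 ℤ.* (x ℤ.* x)
  fromℤ-x² : fromℤ (x ℤ.* x) ≡ y * y
  fromℤ-x² = fromℤ-* x x
  fromℤ-x³ : fromℤ (x ℤ.* x ℤ.* x) ≡ y * y * y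
  fromℤ-x³ = trans (fromℤ-* (x ℤ.* x) x) (cong (_* y) fromℤ-x²)
  fromℤ-cubic : fromℤ cubic ≡ 1 + 2 * y + 5 * (y * y)
  fromℤ-cubic = trans (fromℤ-+ (1ℤ ℤ.+ + 2 ℤ.* x) _)
    (cong₂ _+_ (trans (fromℤ-+ 1ℤ (+ 2 ℤ.* x)) (cong (λ t → 1 + t) (fromℤ-* (+ 2) x)))
               (trans (fromℤ-* (+ 5) (x ℤ.* x)) (cong (5 *_) fromℤ-x²)))

fromℕ-q : ∀ n → let N = fromℕ n in fromℕ (q n) ≡ (2 * N + 1) * (N + N * N + 1)
fromℕ-q n = begin
  fromℕ (q n)                                          ≡⟨ fromℕ-* (suc (2 ℕ.* n)) (suc (n ℕ.+ n ℕ.* n)) ⟩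
  fromℕ (suc (2 ℕ.* n)) * fromℕ (suc (n ℕ.+ n ℕ.* n))   ≡⟨ cong₂ _*_ (fromℕ-suc (2 ℕ.* n)) (fromℕ-suc (n ℕ.+ n ℕ.* n)) ⟩
  (fromℕ (2 ℕ.* n) + 1) * (fromℕ (n ℕ.+ n ℕ.* n) + 1)   ≡⟨ cong₂ (λ s t → (s + 1) * (t + 1)) (fromℕ-* 2 n)
                                                             (trans (fromℕ-+ n (n ℕ.* n)) (cong (λ t → N + t) (fromℕ-* n n))) ⟩
  (2 * N + 1) * (N + N * N + 1)                        ∎
  where
  open ≡-Reasoning
  N : ℚ
  N = fromℕ n

R-penultimate-cleared : ∀ n → ((ℤ.- p (ℤ.- (+ (1 ℕ.+ n)))) / q n) * fromℕ (q n) ≡ - pℚ (- (fromℕ n + 1))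
R-penultimate-cleared n = begin
  ((ℤ.- p (ℤ.- + suc n)) / q n) * fromℕ (q n)   ≡⟨ [z/d]*d≡z (ℤ.- p (ℤ.- + suc n)) (q n) ⟩
  fromℤ (ℤ.- p (ℤ.- + suc n))                   ≡⟨ fromℤ-neg (p (ℤ.- + suc n)) ⟩
  - fromℤ (p (ℤ.- + suc n))                     ≡⟨ cong -_ (fromℤ-p (ℤ.- + suc n)) ⟩
  - pℚ (fromℤ (ℤ.- + suc n))                    ≡⟨ cong (λ y → - pℚ y) (trans (fromℤ-neg (+ suc n)) (cong -_ (fromℕ-suc n))) ⟩
  - pℚ (- (fromℕ n + 1))                        ∎
  where open ≡-Reasoning

R-last-cleared : ∀ n → (p (+ n) / q n) * fromℕ (q n) ≡ pℚ (fromℕ n)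
R-last-cleared n = trans ([z/d]*d≡z (p (+ n)) (q n)) (fromℤ-p (+ n))

cube : ℚ → ℚ
cube a = a * a * a

Σℚ-++ : ∀ xs ys → Σℚ (xs ++ ys) ≡ Σℚ xs + Σℚ ys
Σℚ-++ []       ys = sym (+-identityˡ (Σℚ ys))
Σℚ-++ (x ∷ xs) ys = trans (cong (_+_ x) (Σℚ-++ xs ys)) (sym (+-assoc x (Σℚ xs) (Σℚ ys)))

Σℚ-++-pair : ∀ xs a b → Σℚ (xs ++ a ∷ b ∷ []) ≡ Σℚ xs + a + b
Σℚ-++-pair xs a b = begin
  Σℚ (xs ++ a ∷ b ∷ [])    ≡⟨ Σℚ-++ xs (a ∷ b ∷ []) ⟩
  Σℚ xs + (a + (b + 0ℚ))   ≡⟨ cong (λ t → Σℚ xs + (a + t)) (+-identityʳ b) ⟩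
  Σℚ xs + (a + b)          ≡⟨ +-assoc (Σℚ xs) a b ⟨
  Σℚ xs + a + b            ∎
  where open ≡-Reasoning

Σℚ-upTo-suc : ∀ (f : ℕ → ℚ) m → Σℚ (map f (upTo (suc m))) ≡ Σℚ (map f (upTo m)) + f m
Σℚ-upTo-suc f m = begin
  Σℚ (map f (upTo (suc m)))          ≡⟨ cong (Σℚ ∘ map f) (List.upTo-∷ʳ m) ⟨
  Σℚ (map f (upTo m ++ [ m ]))       ≡⟨ cong Σℚ (List.map-++ f (upTo m) [ m ]) ⟩
  Σℚ (map f (upTo m) ++ [ f m ])     ≡⟨ Σℚ-++ (map f (upTo m)) [ f m ] ⟩
  Σℚ (map f (upTo m)) + (f m + 0ℚ)   ≡⟨ cong (_+_ (Σℚ (map f (upTo m)))) (+-identityʳ (f m)) ⟩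
  Σℚ (map f (upTo m)) + f m          ∎
  where open ≡-Reasoning

Σℚ-telescope : ∀ c (f F : ℕ → ℚ) → F 0 ≡ 0ℚ → (∀ i → F (suc i) ≡ F i + c * f i) →
               ∀ m → c * Σℚ (map f (upTo m)) ≡ F m
Σℚ-telescope c f F F0≡0 step zero    = trans (*-zeroʳ c) (sym F0≡0)
Σℚ-telescope c f F F0≡0 step (suc m) = begin
  c * Σℚ (map f (upTo (suc m)))       ≡⟨ cong (c *_) (Σℚ-upTo-suc f m) ⟩
  c * (Σℚ (map f (upTo m)) + f m)     ≡⟨ *-distribˡ-+ c (Σℚ (map f (upTo m))) (f m) ⟩
  c * Σℚ (map f (upTo m)) + c * f m   ≡⟨ cong (_+ c * f m) (Σℚ-telescope c f F F0≡0 step m) ⟩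
  F m + c * f m                       ≡⟨ step m ⟨
  F (suc m)                           ∎
  where open ≡-Reasoning

twoUpTo : ℕ → List ℚ
twoUpTo n = map (λ k → + k / 1) (map (λ i → 2 ℕ.+ i) (upTo (n ℕ.∸ 1)))

twoUpTo-suc : ∀ m → twoUpTo (suc m) ≡ map (λ i → fromℕ (suc i) + 1) (upTo m)
twoUpTo-suc m = begin
  twoUpTo (suc m)                          ≡⟨ List.map-∘ (upTo m) ⟨
  map (λ i → + (2 ℕ.+ i) / 1) (upTo m)     ≡⟨ List.map-cong (λ i → trans (z/1≡fromℤ _) (fromℕ-suc (suc i))) (upTo m) ⟩
  map (λ i → fromℕ (suc i) + 1) (upTo m)   ∎
  where open ≡-Reasoning

-- The arity argument of solve is an overloaded literal, so the implicit λ of its last argument is written out.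
sum-twoUpTo : ∀ m → let N = fromℕ (suc m) in 2 * Σℚ (twoUpTo (suc m)) ≡ N * (N + 1) - 2
sum-twoUpTo m = begin
  2 * Σℚ (twoUpTo (suc m))                          ≡⟨ cong (λ xs → 2 * Σℚ xs) (twoUpTo-suc m) ⟩
  2 * Σℚ (map (λ i → fromℕ (suc i) + 1) (upTo m))   ≡⟨ Σℚ-telescope 2 (λ i → fromℕ (suc i) + 1) F refl step m ⟩
  F m                                               ∎
  where
  open ≡-Reasoning
  F : ℕ → ℚ
  F m = let N = fromℕ (suc m) in N * (N + 1) - 2
  gauss-step : ∀ N → (N + 1) * (N + 1 + 1) - 2 ≡ N * (N + 1) - 2 + 2 * (N + 1)
  gauss-step = solve 1 (λ N → (N :+ con 1) :* (N :+ con 1 :+ con 1) :- con 2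
                            := N :* (N :+ con 1) :- con 2 :+ con 2 :* (N :+ con 1)) λ {_} → refl
  step : ∀ i → F (suc i) ≡ F i + 2 * (fromℕ (suc i) + 1)
  step i = trans (cong (λ M → M * (M + 1) - 2) (fromℕ-suc (suc i))) (gauss-step (fromℕ (suc i)))

sum-cubes-twoUpTo : ∀ m → let N = fromℕ (suc m) in
                    4 * Σℚ (map cube (twoUpTo (suc m))) ≡ N * N * ((N + 1) * (N + 1)) - 4
sum-cubes-twoUpTo m = begin
  4 * Σℚ (map cube (twoUpTo (suc m)))                          ≡⟨ cong (λ xs → 4 * Σℚ (map cube xs)) (twoUpTo-suc m) ⟩
  4 * Σℚ (map cube (map (λ i → fromℕ (suc i) + 1) (upTo m)))   ≡⟨ cong (λ xs → 4 * Σℚ xs) (List.map-∘ (upTo m)) ⟨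
  4 * Σℚ (map (λ i → cube (fromℕ (suc i) + 1)) (upTo m))       ≡⟨ Σℚ-telescope 4 (λ i → cube (fromℕ (suc i) + 1)) F refl step m ⟩
  F m                                                          ∎
  where
  open ≡-Reasoning
  F : ℕ → ℚ
  F m = let N = fromℕ (suc m) in N * N * ((N + 1) * (N + 1)) - 4
  nicomachus-step : ∀ N → (N + 1) * (N + 1) * ((N + 1 + 1) * (N + 1 + 1)) - 4
                        ≡ N * N * ((N + 1) * (N + 1)) - 4 + 4 * ((N + 1) * (N + 1) * (N + 1))
  nicomachus-step = solve 1 (λ N →
    (N :+ con 1) :* (N :+ con 1) :* ((N :+ con 1 :+ con 1) :* (N :+ con 1 :+ con 1)) :- con 4
    := N :* N :* ((N :+ con 1) :* (N :+ con 1)) :- con 4 :+ con 4 :* ((N :+ con 1) :* (N :+ con 1) :* (N :+ con 1)))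
    λ {_} → refl
  step : ∀ i → F (suc i) ≡ F i + 4 * cube (fromℕ (suc i) + 1)
  step i = trans (cong (λ M → M * M * ((M + 1) * (M + 1)) - 4) (fromℕ-suc (suc i))) (nicomachus-step (fromℕ (suc i)))

ν-++-pair : ∀ xs a b → let S = Σℚ xs ; C = Σℚ (map cube xs) in
            ν (xs ++ a ∷ b ∷ []) ≡ (S + a + b) * (S + a + b) - (C + cube a + cube b)
ν-++-pair xs a b = cong₂ (λ s c → s * s - c) (Σℚ-++-pair xs a b) (begin
  Σℚ (map cube (xs ++ a ∷ b ∷ []))           ≡⟨ cong Σℚ (List.map-++ cube xs (a ∷ b ∷ [])) ⟩
  Σℚ (map cube xs ++ cube a ∷ cube b ∷ [])   ≡⟨ Σℚ-++-pair (map cube xs) (cube a) (cube b) ⟩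
  Σℚ (map cube xs) + cube a + cube b         ∎)
  where open ≡-Reasoning

-- 4Q³ · ν for the sums S = X/2, C = Y/4 and the extra entries U/Q, V/Q.
clearedν : (Q X Y U V : ℚ) → ℚ
clearedν Q X Y U V =
  Q * (Q * X + 2 * U + 2 * V) * (Q * X + 2 * U + 2 * V) - Q * Q * Q * Y - 4 * cube U - 4 * cube V

-- Solver syntax for clearedν and pℚ; they evaluate to them definitionally.
clearedνₑ : ∀ {n} (Q X Y U V : Polynomial n) → Polynomial n
clearedνₑ Q X Y U V =
  Q :* (Q :* X :+ con 2 :* U :+ con 2 :* V) :* (Q :* X :+ con 2 :* U :+ con 2 :* V)
  :- Q :* Q :* Q :* Y :- con 4 :* (U :* U :* U) :- con 4 :* (V :* V :* V)

pℚₑ : ∀ {n} → Polynomial n → Polynomial n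
pℚₑ y = (con 1 :+ y) :* (con 1 :+ con 2 :* y :+ con 5 :* (y :* y) :+ y :* y :* y)

ν-pair-cleared : ∀ S C a b Q →
  ((S + a + b) * (S + a + b) - (C + cube a + cube b)) * Q * Q * Q * 4 ≡ clearedν Q (2 * S) (4 * C) (a * Q) (b * Q)
ν-pair-cleared = solve 5 (λ S C a b Q →
  ((S :+ a :+ b) :* (S :+ a :+ b) :- (C :+ a :* a :* a :+ b :* b :* b)) :* Q :* Q :* Q :* con 4
  := clearedνₑ Q (con 2 :* S) (con 4 :* C) (a :* Q) (b :* Q)) λ {_ _ _ _ _} → refl

R-cleared-vanishes : ∀ N Q X Y U V →
  Q ≡ (2 * N + 1) * (N + N * N + 1) → X ≡ N * (N + 1) - 2 → Y ≡ N * N * ((N + 1) * (N + 1)) - 4 →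
  U ≡ - pℚ (- (N + 1)) → V ≡ pℚ N → clearedν Q X Y U V ≡ 0ℚ
R-cleared-vanishes N _ _ _ _ _ refl refl refl refl refl = solve 1 (λ N →
  clearedνₑ ((con 2 :* N :+ con 1) :* (N :+ N :* N :+ con 1)) (N :* (N :+ con 1) :- con 2)
            (N :* N :* ((N :+ con 1) :* (N :+ con 1)) :- con 4) (:- pℚₑ (:- (N :+ con 1))) (pℚₑ N)
  := con 0ℚ) (λ {_} → refl) N

x*y≡0⇒x≡0 : ∀ x y .{{_ : NonZero y}} → x * y ≡ 0ℚ → x ≡ 0ℚ
x*y≡0⇒x≡0 x y xy≡0 = begin
  x                ≡⟨ *-identityʳ x ⟨
  x * 1            ≡⟨ cong (x *_) (*-inverseʳ y) ⟨
  x * (y * 1/ y)   ≡⟨ *-assoc x y (1/ y) ⟨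
  x * y * 1/ y     ≡⟨ cong (_* 1/ y) xy≡0 ⟩
  0ℚ * 1/ y        ≡⟨ *-zeroˡ (1/ y) ⟩
  0ℚ               ∎
  where open ≡-Reasoning

x*Q³*4≡0⇒x≡0 : ∀ x Q .{{_ : NonZero Q}} → x * Q * Q * Q * 4 ≡ 0ℚ → x ≡ 0ℚ
x*Q³*4≡0⇒x≡0 x Q eq = x*y≡0⇒x≡0 x Q (x*y≡0⇒x≡0 _ Q (x*y≡0⇒x≡0 _ Q (x*y≡0⇒x≡0 _ 4 {{pos⇒nonZero 4}} eq)))

-- The argument also works for n = 1; the hypothesis only rules out n = 0.
mainTheorem8 : (n : ℕ) → 2 ≤ n → ν (R n) ≡ 0ℚ
mainTheorem8 n@(suc m) _ = x*Q³*4≡0⇒x≡0 (ν (R n)) Q (begin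
  ν (R n) * Q * Q * Q * 4
    ≡⟨ cong (λ e → e * Q * Q * Q * 4) (ν-++-pair (twoUpTo n) a b) ⟩
  ((S + a + b) * (S + a + b) - (C + cube a + cube b)) * Q * Q * Q * 4
    ≡⟨ ν-pair-cleared S C a b Q ⟩
  clearedν Q (2 * S) (4 * C) (a * Q) (b * Q)
    ≡⟨ R-cleared-vanishes (fromℕ n) Q (2 * S) (4 * C) (a * Q) (b * Q)
         (fromℕ-q n) (sum-twoUpTo m) (sum-cubes-twoUpTo m) (R-penultimate-cleared n) (R-last-cleared n) ⟩
  0ℚ ∎)
  where
  open ≡-Reasoning
  Q a b S C : ℚ
  Q = fromℕ (q n)
  a = (ℤ.- p (ℤ.- (+ (1 ℕ.+ n)))) / q n
  b = p (+ n) / q n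
  S = Σℚ (twoUpTo n)
  C = Σℚ (map cube (twoUpTo n))
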